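{- Let $k$ be a positive integer, $n\ge k+2$, let $\mathcal F$ be a union-closed family over the universe $[k]$, and let $\mathcal H=\mathcal F\cup\{[n]\}$ (a union-closed family over $[n]$). For $A\subseteq[n]$ write $A_1=A\cap[k]$ and $A_2=A\cap([n]\setminus[k])$. Let $A\in 2^{[n]}$ and let $t$ be an integer with $1\le t\le k$. If $A$ satisfies any of the conditions (i) $A_2=\emptyset$ and $A_1\in\overline{\mathcal F}^{(t)}$; (iii) $A_2=[n]\setminus[k]$ and for every $E\in\overline{\mathcal F}^{(t-1)}$ with $E\not\subseteq A$ we have $E\cup A\in\overline{\mathcal H}^{(t-1)}$; (v) $|A_1|\ge k-t+1$; then $A\in\overline{\mathcal H}^{(t)}$. If $A$ satisfies any of the conditions (ii) $A_2=\emptyset$ and $A_1\notin\overline{\mathcal F}^{(t)}$; (iv) $A_2=[n]\setminus[k]$ and there exists $E\in\overline{\mathcal F}^{(t-1)}$ with $E\not\subseteq A$ and $E\cup A\notin\overline{\mathcal H}^{(t-1)}$; (vi) $A_2\neq\emptyset$, $A_2\ne[n]\setminus[k]$ and $|A_1|\le k-t$; then $A\notin\overline{\mathcal H}^{(t)}$.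
   Context: A family $\mathcal F$ of subsets of a universe $[m]=\{1,\dots,m\}$ is union-closed over $[m]$ if $[m]\in\mathcal F$ and $A\cup B\in\mathcal F$ for all $A,B\in\mathcal F$. Convention: the empty set is never a member of any family considered; $2^{[m]}$ denotes the family of all nonempty subsets of $[m]$. The closure of a union-closed family $\mathcal F$ over $[m]$ is $\overline{\mathcal F}=\{A\in 2^{[m]}:\ \mathcal F\cup\{A\}\text{ is union-closed}\}$; iterated closures are $\overline{\mathcal F}^{(0)}=\mathcal F$, $\overline{\mathcal F}^{(i)}=\overline{\overline{\mathcal F}^{(i-1)}}$. Here closures of $\mathcal F$ are taken over the universe $[k]$ and closures of $\mathcal H$ over the universe $[n]$. -}

module Defs where

open import Data.Nat using (ℕ; zero; suc; _+_)
open import Data.Product using (_×_; ∃)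
open import Data.Sum using (_⊎_)
open import Data.Vec using (_++_; take; drop)
open import Data.Fin.Subset using (Subset; _∪_; ⊤; ⊥; Nonempty)
open import Relation.Binary.PropositionalEquality using (_≡_)

Family : ℕ → Set₁
Family m = Subset m → Set

_∪⟦_⟧ : ∀ {m} → Family m → Subset m → Family m
(F ∪⟦ A ⟧) B = F B ⊎ B ≡ A

UnionClosed : ∀ m → Family m → Set
UnionClosed m F = F ⊤ × (∀ A B → F A → F B → F (A ∪ B))

closure : ∀ m → Family m → Family m
closure m F A = Nonempty A × UnionClosed m (F ∪⟦ A ⟧)

closureIter : ∀ m → ℕ → Family m → Family m
closureIter m zero    F = F
closureIter m (suc i) F = closure m (closureIter m i F)

-- embedding a subset of [k] into [k + d] (the universe [n], n = k + d)
embed : ∀ {k} d → Subset k → Subset (k + d)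
embed d B = B ++ ⊥

-- H = F ∪ {[n]} viewed as a family over [k + d]
extend : ∀ k d → Family k → Family (k + d)
extend k d F A = (∃ λ B → F B × A ≡ embed d B) ⊎ A ≡ ⊤

-- A₁ = A ∩ [k],  A₂ = A ∩ ([n] ∖ [k])
part₁ : ∀ k {d} → Subset (k + d) → Subset k
part₁ k A = take k A

part₂ : ∀ k {d} → Subset (k + d) → Subset d
part₂ k A = drop k A

module Submission where

-- Write G s = closureIter k s F over [k], K s = closureIter (k + d) s H over
-- [k + d] for H = F ∪ {[k + d]}, and split every A ⊆ [k + d] as A = A₁ ++ A₂
-- (the low part A₁ ⊆ [k] and the high part A₂ ⊆ [d]).
--
-- Everything rests on one description of the closure of a union-closed K:
-- A ∈ closure K iff A ≠ ∅ and each B ∈ K has B ⊆ A or A ∪ B ∈ K; moreover the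
-- closure is again union-closed.  From this, G s contains every nonempty set
-- missing at most s points of [k].  The heart of the proof is one induction
-- on s establishing the four facts about K s collected in the record Level:
--   * an embedded set E ++ ∅ lies in K s iff E lies in G s (two facts);
--   * a nonempty A whose low part is not thin (∣ A₁ ∣ + s > k) lies in K s;
--   * a mixed member A of K s (∅ ≠ A₂ ≠ [d]) never has a thin low part.
-- The step uses a membership criterion for K (s + 1) that only tests embedded
-- members of K s: members with full high part are closed upwards, and mixed
-- members are not thin, so neither is their union with A.

open import Defs
open import Data.Nat using (ℕ; zero; suc; _+_; _∸_; _≤_; _<_; z≤n; s≤s)
open import Data.Nat.Properties
  using (≤-trans; ≤-reflexive; ≤-antisym; <⇒≱; ≰⇒>; +-suc; +-identityʳ; +-monoˡ-≤;
         n≤1+n; m∸n≤m; m∸n+n≡m; m+n≤o⇒n≤o; m+n≤o⇒m≤o∸n; m≤o∸n⇒m+n≤o; _≤?_)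
open import Data.Product using (_×_; Σ; ∃; _,_; proj₁; proj₂; uncurry)
open import Data.Sum using (_⊎_; inj₁; inj₂; [_,_]′)
open import Data.Vec using ([]; _∷_; _++_; here; there)
open import Data.Vec.Properties
  using (take++drop≡id; ++-injectiveˡ; ++-injectiveʳ; take-zipWith; drop-zipWith; zipWith-++; ≡-dec)
open import Data.Bool using (_∨_) renaming (_≟_ to _≟ᴮ_)
import Data.Fin as Fin
open import Data.Fin.Subset using (Subset; _∪_; _⊆_; _∈_; ⊤; ⊥; Nonempty; ∣_∣; inside; outside)
open import Data.Fin.Subset.Properties
  using (p⊆p∪q; q⊆p∪q; x∈p∪q⁻; ∪-comm; ∪-assoc; ∪-idem; ∪-zeroˡ; ∪-identityʳ; ⊆-antisym; ⊆⊤;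
         _⊆?_; ⊥⊆; drop-∷-⊆; out⊆; in⊆in; ∉⊥; ∣p∣≤n; ∣⊤∣≡n; ∣p∣≡n⇒p≡⊤; ∣p∣≤∣p∪q∣; p⊆q⇒∣p∣≤∣q∣)
open import Data.Empty using () renaming (⊥-elim to absurd)
open import Relation.Nullary using (¬_; yes; no)
open import Relation.Binary.PropositionalEquality using (_≡_; refl; sym; trans; cong; subst)

∪-least : ∀ {n} {P Q R : Subset n} → P ⊆ R → Q ⊆ R → P ∪ Q ⊆ R
∪-least {P = P} {Q} P⊆R Q⊆R x∈P∪Q = [ P⊆R , Q⊆R ]′ (x∈p∪q⁻ P Q x∈P∪Q)

⊆⇒∪≡ : ∀ {n} {P Q : Subset n} → P ⊆ Q → P ∪ Q ≡ Q
⊆⇒∪≡ {P = P} {Q} P⊆Q = ⊆-antisym (∪-least P⊆Q (λ x∈Q → x∈Q)) (q⊆p∪q P Q)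

∪-monoˡ : ∀ {n} {P Q R : Subset n} → P ⊆ Q → P ∪ R ⊆ Q ∪ R
∪-monoˡ {Q = Q} {R} P⊆Q = ∪-least (λ x∈P → p⊆p∪q R (P⊆Q x∈P)) (q⊆p∪q Q R)

∪-nonempty : ∀ {n} {P : Subset n} (Q : Subset n) → Nonempty P → Nonempty (P ∪ Q)
∪-nonempty Q (x , x∈P) = x , p⊆p∪q Q x∈P

⊆-nonempty : ∀ {n} {P Q : Subset n} → P ⊆ Q → Nonempty P → Nonempty Q
⊆-nonempty P⊆Q (x , x∈P) = x , P⊆Q x∈P

size-nonempty : ∀ {n} (P : Subset n) → 0 < ∣ P ∣ → Nonempty P
size-nonempty (inside ∷ P) _ = Fin.zero , here
size-nonempty (outside ∷ P) 0<∣P∣ =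
  let x , x∈P = size-nonempty P 0<∣P∣ in Fin.suc x , there x∈P

∣p∣<∣p∪q∣ : ∀ {n} (P Q : Subset n) → ¬ Q ⊆ P → ∣ P ∣ < ∣ P ∪ Q ∣
∣p∣<∣p∪q∣ [] [] Q⊈P = absurd (Q⊈P (λ x∈Q → x∈Q))
∣p∣<∣p∪q∣ (outside ∷ P) (inside ∷ Q) _ = s≤s (∣p∣≤∣p∪q∣ P Q)
∣p∣<∣p∪q∣ (outside ∷ P) (outside ∷ Q) Q⊈P = ∣p∣<∣p∪q∣ P Q (λ Q⊆P → Q⊈P (out⊆ Q⊆P))
∣p∣<∣p∪q∣ (inside ∷ P) (outside ∷ Q) Q⊈P = s≤s (∣p∣<∣p∪q∣ P Q (λ Q⊆P → Q⊈P (out⊆ Q⊆P)))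
∣p∣<∣p∪q∣ (inside ∷ P) (inside ∷ Q) Q⊈P = s≤s (∣p∣<∣p∪q∣ P Q (λ Q⊆P → Q⊈P (in⊆in Q⊆P)))

superset-of-size : ∀ {n} (P : Subset n) m → ∣ P ∣ ≤ m → m ≤ n → ∃ λ C → P ⊆ C × ∣ C ∣ ≡ m
superset-of-size [] zero _ _ = [] , (λ x∈P → x∈P) , refl
superset-of-size (inside ∷ P) (suc m) (s≤s ∣P∣≤m) (s≤s m≤n) =
  let C , P⊆C , ∣C∣≡m = superset-of-size P m ∣P∣≤m m≤n in inside ∷ C , in⊆in P⊆C , cong suc ∣C∣≡m
superset-of-size {suc n} (outside ∷ P) m ∣P∣≤m m≤1+n with m ≤? n
... | yes m≤n =
  let C , P⊆C , ∣C∣≡m = superset-of-size P m ∣P∣≤m m≤n in outside ∷ C , out⊆ P⊆C , ∣C∣≡m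
... | no m≰n = ⊤ , ⊆⊤ , trans (∣⊤∣≡n (suc n)) (≤-antisym (≰⇒> m≰n) m≤1+n)

split : ∀ k {d} (A : Subset (k + d)) → part₁ k A ++ part₂ k A ≡ A
split k A = take++drop≡id k A

part₁-++ : ∀ {k d} (X : Subset k) (Y : Subset d) → part₁ k (X ++ Y) ≡ X
part₁-++ {k} X Y = ++-injectiveˡ (part₁ k (X ++ Y)) X (split k (X ++ Y))

part₂-++ : ∀ {k d} (X : Subset k) (Y : Subset d) → part₂ k (X ++ Y) ≡ Y
part₂-++ {k} X Y = ++-injectiveʳ (part₁ k (X ++ Y)) X (split k (X ++ Y))

part₁-∪ : ∀ k {d} (P Q : Subset (k + d)) → part₁ k (P ∪ Q) ≡ part₁ k P ∪ part₁ k Q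
part₁-∪ k P Q = take-zipWith _∨_ P Q

part₂-∪ : ∀ k {d} (P Q : Subset (k + d)) → part₂ k (P ∪ Q) ≡ part₂ k P ∪ part₂ k Q
part₂-∪ k P Q = drop-zipWith _∨_ P Q

part₂-⊤ : ∀ k {d} → part₂ k {d} ⊤ ≡ ⊤
part₂-⊤ zero = refl
part₂-⊤ (suc k) = part₂-⊤ k

embed-∪ : ∀ {k} d (E E′ : Subset k) → embed d E ∪ embed d E′ ≡ embed d (E ∪ E′)
embed-∪ d E E′ = trans (zipWith-++ _∨_ E ⊥ E′ ⊥) (cong ((E ∪ E′) ++_) (∪-idem ⊥))

++-⊆⁺ : ∀ {k d} {X X′ : Subset k} {Y Y′ : Subset d} → X ⊆ X′ → Y ⊆ Y′ → X ++ Y ⊆ X′ ++ Y′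
++-⊆⁺ {X = []} {[]} _ Y⊆Y′ x∈Y = Y⊆Y′ x∈Y
++-⊆⁺ {X = _ ∷ X} {_ ∷ X′} X⊆X′ Y⊆Y′ here with X⊆X′ here
... | here = here
++-⊆⁺ {X = _ ∷ X} {_ ∷ X′} X⊆X′ Y⊆Y′ (there x∈XY) = there (++-⊆⁺ (drop-∷-⊆ X⊆X′) Y⊆Y′ x∈XY)

++-⊆⁻ˡ : ∀ {k d} {X X′ : Subset k} {Y Y′ : Subset d} → X ++ Y ⊆ X′ ++ Y′ → X ⊆ X′
++-⊆⁻ˡ {X = _ ∷ X} {_ ∷ X′} XY⊆ here with XY⊆ here
... | here = here
++-⊆⁻ˡ {X = _ ∷ X} {_ ∷ X′} {Y} {Y′} XY⊆ (there x∈X) =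
  there (++-⊆⁻ˡ {X = X} {X′} {Y} {Y′} (drop-∷-⊆ XY⊆) x∈X)

part₁-mono : ∀ k {d} {P Q : Subset (k + d)} → P ⊆ Q → part₁ k P ⊆ part₁ k Q
part₁-mono k {P = P} {Q} P⊆Q =
  ++-⊆⁻ˡ {Y = part₂ k P} {part₂ k Q}
    (subst (_⊆ _) (sym (split k P)) (subst (P ⊆_) (sym (split k Q)) P⊆Q))

⊆-from-parts : ∀ k {d} {P Q : Subset (k + d)} →
  part₁ k P ⊆ part₁ k Q → part₂ k P ⊆ part₂ k Q → P ⊆ Q
⊆-from-parts k {P = P} {Q} low⊆ high⊆ =
  subst (_⊆ Q) (split k P) (subst (_ ⊆_) (split k Q) (++-⊆⁺ low⊆ high⊆))

++-nonempty : ∀ {k d} {X : Subset k} (Y : Subset d) → Nonempty X → Nonempty (X ++ Y)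
++-nonempty {X = _ ∷ X} Y (Fin.zero , here) = Fin.zero , here
++-nonempty {X = _ ∷ X} Y (Fin.suc x , there x∈X) =
  let y , y∈XY = ++-nonempty Y (x , x∈X) in Fin.suc y , there y∈XY

embed-nonempty⁻ : ∀ {k} d {E : Subset k} → Nonempty (embed d E) → Nonempty E
embed-nonempty⁻ d {[]} (x , x∈⊥) = absurd (∉⊥ x∈⊥)
embed-nonempty⁻ d {_ ∷ E} (Fin.zero , here) = Fin.zero , here
embed-nonempty⁻ d {_ ∷ E} (Fin.suc x , there x∈E⊥) =
  let y , y∈E = embed-nonempty⁻ d (x , x∈E⊥) in Fin.suc y , there y∈E

closure-intro : ∀ {m} {K : Family m} {A : Subset m} → UnionClosed m K → Nonempty A →
  (∀ B → K B → B ⊆ A ⊎ K (A ∪ B)) → closure m K A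
closure-intro {K = K} {A} (K⊤ , K∪) A≠∅ test = A≠∅ , inj₁ K⊤ , union
  where
  joinA : ∀ B → K B → (K ∪⟦ A ⟧) (A ∪ B)
  joinA B KB = [ (λ (B⊆A : B ⊆ A) → inj₂ (trans (∪-comm A B) (⊆⇒∪≡ B⊆A))) , inj₁ ]′ (test B KB)

  union : ∀ B C → (K ∪⟦ A ⟧) B → (K ∪⟦ A ⟧) C → (K ∪⟦ A ⟧) (B ∪ C)
  union B C (inj₁ KB) (inj₁ KC) = inj₁ (K∪ B C KB KC)
  union B .A (inj₁ KB) (inj₂ refl) = subst (K ∪⟦ A ⟧) (∪-comm A B) (joinA B KB)
  union .A C (inj₂ refl) (inj₁ KC) = joinA C KC
  union .A .A (inj₂ refl) (inj₂ refl) = inj₂ (∪-idem A)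

closure-elim : ∀ {m} {K : Family m} {A B : Subset m} → closure m K A → K B → B ⊆ A ⊎ K (A ∪ B)
closure-elim {A = A} {B} (_ , _ , union) KB =
  [ inj₂ , (λ A∪B≡A → inj₁ (λ {x} x∈B → subst (x ∈_) A∪B≡A (q⊆p∪q A B x∈B))) ]′
    (union A B (inj₂ refl) (inj₁ KB))

closure-unionClosed : ∀ {m} {K : Family (suc m)} →
  UnionClosed (suc m) K → UnionClosed (suc m) (closure (suc m) K)
closure-unionClosed {m} {K} ucK = closure-intro ucK (Fin.zero , here) (λ _ _ → inj₁ ⊆⊤) , union
  where
  union : ∀ A A′ → closure (suc m) K A → closure (suc m) K A′ → closure (suc m) K (A ∪ A′)
  union A A′ clA clA′ = closure-intro ucK (∪-nonempty A′ (proj₁ clA)) test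
    where
    reassoc : ∀ B → A′ ∪ (A ∪ B) ≡ (A ∪ A′) ∪ B
    reassoc B = trans (sym (∪-assoc A′ A B)) (cong (_∪ B) (∪-comm A′ A))

    test : ∀ B → K B → B ⊆ A ∪ A′ ⊎ K ((A ∪ A′) ∪ B)
    test B KB with closure-elim clA KB
    ... | inj₁ B⊆A = inj₁ (λ x∈B → p⊆p∪q A′ (B⊆A x∈B))
    ... | inj₂ K[A∪B] with closure-elim clA′ K[A∪B]
    ...   | inj₁ A∪B⊆A′ = inj₁ (λ x∈B → q⊆p∪q A A′ (A∪B⊆A′ (q⊆p∪q A B x∈B)))
    ...   | inj₂ K[A′∪A∪B] = inj₂ (subst K (reassoc B) K[A′∪A∪B])

closureIter-unionClosed : ∀ {m} {K : Family (suc m)} → UnionClosed (suc m) K →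
  ∀ s → UnionClosed (suc m) (closureIter (suc m) s K)
closureIter-unionClosed ucK zero = ucK
closureIter-unionClosed ucK (suc s) = closure-unionClosed (closureIter-unionClosed ucK s)

-- Trading one closure step for one more point keeps the weight ∣ X ∣ + s.
m<n⇒m+[1+o]≤n+o : ∀ o {m n} → m < n → m + suc o ≤ n + o
m<n⇒m+[1+o]≤n+o o {m} m<n = ≤-trans (≤-reflexive (+-suc m o)) (+-monoˡ-≤ o m<n)

-- The s-th closure of a union-closed family over [m] contains every nonempty
-- set missing at most s points: each step may absorb one more point.
fat-in-closureIter : ∀ {m} {F : Family (suc m)} → UnionClosed (suc m) F →
  ∀ s C → Nonempty C → suc m ≤ ∣ C ∣ + s → closureIter (suc m) s F C
fat-in-closureIter {F = F} ucF zero C _ fat =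
  subst F (sym (∣p∣≡n⇒p≡⊤ (≤-antisym (∣p∣≤n C) (≤-trans fat (≤-reflexive (+-identityʳ _))))))
    (proj₁ ucF)
fat-in-closureIter ucF (suc s) C C≠∅ fat =
  closure-intro (closureIter-unionClosed ucF s) C≠∅ test
  where
  test : ∀ B → closureIter _ s _ B → B ⊆ C ⊎ closureIter _ s _ (C ∪ B)
  test B _ with B ⊆? C
  ... | yes B⊆C = inj₁ B⊆C
  ... | no B⊈C = inj₂ (fat-in-closureIter ucF s (C ∪ B) (∪-nonempty B C≠∅)
                   (≤-trans fat (m<n⇒m+[1+o]≤n+o s (∣p∣<∣p∪q∣ C B B⊈C))))

module Extension (k′ d′ : ℕ) (F : Family (suc k′)) (ucF : UnionClosed (suc k′) F) where

  k d : ℕ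
  k = suc k′
  d = suc d′

  H : Family (k + d)
  H = extend k d F

  G : ℕ → Family k
  G s = closureIter k s F

  K : ℕ → Family (k + d)
  K s = closureIter (k + d) s H

  low : Subset (k + d) → Subset k
  low = part₁ k

  high : Subset (k + d) → Subset d
  high = part₂ k

  Mixed : Subset (k + d) → Set
  Mixed A = ¬ high A ≡ ⊥ × ¬ high A ≡ ⊤

  Thin : ℕ → Subset k → Set
  Thin s X = ∣ X ∣ + s ≤ k

  -- The high block is nonempty, so embedded sets never have full high part.
  ⊥≢⊤ : ¬ ⊥ {d} ≡ ⊤
  ⊥≢⊤ ()

  high-embed : ∀ (E : Subset k) → high (embed d E) ≡ ⊥
  high-embed E = part₂-++ E ⊥

  low-embed : ∀ (E : Subset k) → low (embed d E) ≡ E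
  low-embed E = part₁-++ E ⊥

  low-mono : ∀ {P Q : Subset (k + d)} → P ⊆ Q → low P ⊆ low Q
  low-mono = part₁-mono k

  embed-low : ∀ A → high A ≡ ⊥ → embed d (low A) ≡ A
  embed-low A A₂≡⊥ = trans (cong (low A ++_) (sym A₂≡⊥)) (split k A)

  data Shape (A : Subset (k + d)) : Set where
    embedded : ∀ (E : Subset k) → A ≡ embed d E → Shape A
    full     : high A ≡ ⊤ → Shape A
    mixed    : Mixed A → Shape A

  shape : ∀ A → Shape A
  shape A with ≡-dec _≟ᴮ_ (high A) ⊥ | ≡-dec _≟ᴮ_ (high A) ⊤
  ... | yes A₂≡⊥ | _ = embedded (low A) (sym (embed-low A A₂≡⊥))
  ... | no _ | yes A₂≡⊤ = full A₂≡⊤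
  ... | no A₂≢⊥ | no A₂≢⊤ = mixed (A₂≢⊥ , A₂≢⊤)

  H-unionClosed : UnionClosed (k + d) H
  H-unionClosed = inj₂ refl , union
    where
    union : ∀ B C → H B → H C → H (B ∪ C)
    union B C _ (inj₂ refl) = inj₂ (trans (∪-comm B ⊤) (∪-zeroˡ B))
    union B C (inj₂ refl) _ = inj₂ (∪-zeroˡ C)
    union B C (inj₁ (E , FE , refl)) (inj₁ (E′ , FE′ , refl)) =
      inj₁ (E ∪ E′ , proj₂ ucF E E′ FE FE′ , embed-∪ d E E′)

  G-unionClosed : ∀ s → UnionClosed k (G s)
  G-unionClosed = closureIter-unionClosed ucF

  K-unionClosed : ∀ s → UnionClosed (k + d) (K s)
  K-unionClosed = closureIter-unionClosed H-unionClosed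

  upward : ∀ s B C → K s B → high B ≡ ⊤ → B ⊆ C → K s C
  upward zero _ _ (inj₁ (E , _ , refl)) B₂≡⊤ _ = absurd (⊥≢⊤ (trans (sym (high-embed E)) B₂≡⊤))
  upward zero _ _ (inj₂ refl) _ ⊤⊆C = inj₂ (⊆-antisym ⊆⊤ ⊤⊆C)
  upward (suc s) B C KB B₂≡⊤ B⊆C = closure-intro (K-unionClosed s) (⊆-nonempty B⊆C (proj₁ KB)) test
    where
    test : ∀ D → K s D → D ⊆ C ⊎ K s (C ∪ D)
    test D KD with closure-elim KB KD
    ... | inj₁ D⊆B = inj₁ (λ x∈D → B⊆C (D⊆B x∈D))
    ... | inj₂ K[B∪D] = inj₂ (upward s (B ∪ D) (C ∪ D) K[B∪D]
                          (trans (part₂-∪ k B D) (trans (cong (_∪ high D) B₂≡⊤) (∪-zeroˡ (high D))))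
                          (∪-monoˡ B⊆C))

  record Level (s : ℕ) : Set where
    field
      G⇒K       : ∀ E → G s E → K s (embed d E)
      K⇒G       : ∀ E → K s (embed d E) → G s E
      mixed⇒fat : ∀ A → K s A → Mixed A → ¬ Thin s (low A)
      fat⇒K     : ∀ A → Nonempty A → ¬ Thin s (low A) → K s A

  -- At level 0, K 0 = H has only embedded members and [k + d], and no
  -- nonempty set has a non-thin low part.
  level-zero : Level 0
  level-zero = record
    { G⇒K       = λ E FE → inj₁ (E , FE , refl)
    ; K⇒G       = K⇒G-zero
    ; mixed⇒fat = mixed⇒fat-zero
    ; fat⇒K     = λ A _ notThin →
        absurd (notThin (≤-trans (≤-reflexive (+-identityʳ _)) (∣p∣≤n (low A))))
    }
    where
    K⇒G-zero : ∀ E → H (embed d E) → F E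
    K⇒G-zero E (inj₁ (B , FB , E⊥≡B⊥)) = subst F (sym (++-injectiveˡ E B E⊥≡B⊥)) FB
    K⇒G-zero E (inj₂ E⊥≡⊤) =
      absurd (⊥≢⊤ (trans (sym (high-embed E)) (trans (cong high E⊥≡⊤) (part₂-⊤ k))))

    mixed⇒fat-zero : ∀ A → H A → Mixed A → ¬ Thin 0 (low A)
    mixed⇒fat-zero _ (inj₁ (E , _ , refl)) (A₂≢⊥ , _) _ = A₂≢⊥ (high-embed E)
    mixed⇒fat-zero _ (inj₂ refl) (_ , A₂≢⊤) _ = A₂≢⊤ (part₂-⊤ k)

  module Step {s : ℕ} (lvl : Level s) where
    open Level lvl

    -- Membership in K (s + 1) only needs to be tested against embedded members
    -- of K s: members with full high part are absorbed upwards, and the union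
    -- of A with a mixed member is not thin, hence in K s.
    criterion : ∀ A → Nonempty A →
      (∀ (E : Subset k) → K s (embed d E) → ¬ embed d E ⊆ A → K s (A ∪ embed d E)) → K (suc s) A
    criterion A A≠∅ embeddedTest = closure-intro (K-unionClosed s) A≠∅ test
      where
      test : ∀ D → K s D → D ⊆ A ⊎ K s (A ∪ D)
      test D KD with shape D
      ... | embedded E refl with embed d E ⊆? A
      ...   | yes E⊆A = inj₁ E⊆A
      ...   | no E⊈A = inj₂ (embeddedTest E KD E⊈A)
      test D KD | full D₂≡⊤ = inj₂ (upward s D (A ∪ D) KD D₂≡⊤ (q⊆p∪q A D))
      test D KD | mixed mixedD = inj₂ (fat⇒K (A ∪ D) (∪-nonempty D A≠∅) notThin)
        where
        notThin : ¬ Thin s (low (A ∪ D))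
        notThin thin = mixed⇒fat D KD mixedD
          (≤-trans (+-monoˡ-≤ s (p⊆q⇒∣p∣≤∣q∣ (low-mono (q⊆p∪q A D)))) thin)

    -- E ∈ G (s + 1) gives E ++ ∅ ∈ K (s + 1): an embedded member E′ ++ ∅ of K s
    -- not below E ++ ∅ comes from E′ ∈ G s with E′ ⊈ E, so E ∪ E′ ∈ G s.
    G⇒K-suc : ∀ E → G (suc s) E → K (suc s) (embed d E)
    G⇒K-suc E GE = criterion (embed d E) (++-nonempty ⊥ (proj₁ GE)) test
      where
      test : ∀ (E′ : Subset k) → K s (embed d E′) → ¬ embed d E′ ⊆ embed d E →
        K s (embed d E ∪ embed d E′)
      test E′ KE′ E′⊈E with closure-elim GE (K⇒G E′ KE′)
      ... | inj₁ E′⊆E = absurd (E′⊈E (++-⊆⁺ E′⊆E (λ x∈⊥ → x∈⊥)))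
      ... | inj₂ G[E∪E′] = subst (K s) (sym (embed-∪ d E E′)) (G⇒K (E ∪ E′) G[E∪E′])

    -- Conversely, testing E against B ∈ G s is testing E ++ ∅ against B ++ ∅.
    K⇒G-suc : ∀ E → K (suc s) (embed d E) → G (suc s) E
    K⇒G-suc E KE = closure-intro (G-unionClosed s) (embed-nonempty⁻ d (proj₁ KE)) test
      where
      test : ∀ B → G s B → B ⊆ E ⊎ G s (E ∪ B)
      test B GB with closure-elim KE (G⇒K B GB)
      ... | inj₁ B⊥⊆E⊥ = inj₁ (++-⊆⁻ˡ {Y = ⊥ {d}} {⊥} B⊥⊆E⊥)
      ... | inj₂ K[E∪B] = inj₂ (K⇒G (E ∪ B) (subst (K s) (embed-∪ d E B) K[E∪B]))

    -- Absorbing an embedded set not below A makes the low part strictly larger.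
    fat⇒K-suc : ∀ A → Nonempty A → ¬ Thin (suc s) (low A) → K (suc s) A
    fat⇒K-suc A A≠∅ notThin = criterion A A≠∅ test
      where
      test : ∀ (E : Subset k) → K s (embed d E) → ¬ embed d E ⊆ A → K s (A ∪ embed d E)
      test E _ E⊈A = fat⇒K (A ∪ embed d E) (∪-nonempty _ A≠∅) λ thin →
        notThin (≤-trans (m<n⇒m+[1+o]≤n+o s grows) thin)
        where
        E⊈A₁ : ¬ E ⊆ low A
        E⊈A₁ E⊆A₁ = E⊈A (⊆-from-parts k (subst (_⊆ low A) (sym (low-embed E)) E⊆A₁)
                                         (subst (_⊆ high A) (sym (high-embed E)) ⊥⊆))

        low∪ : low (A ∪ embed d E) ≡ low A ∪ E
        low∪ = trans (part₁-∪ k A (embed d E)) (cong (low A ∪_) (low-embed E))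

        grows : ∣ low A ∣ < ∣ low (A ∪ embed d E) ∣
        grows = subst (λ X → ∣ low A ∣ < ∣ X ∣) (sym low∪) (∣p∣<∣p∪q∣ (low A) E E⊈A₁)

    -- A mixed member A of K (s + 1) together with a superset C of A₁ of size
    -- exactly k ∸ s is contradictory: C ∈ G s, and C ++ ∅ is neither below A
    -- nor joinable with A, since A ∪ (C ++ ∅) would be a mixed member of K s
    -- with thin low part C.
    refute-thin : ∀ A C → K (suc s) A → Mixed A → low A ⊆ C → ∣ low A ∣ < ∣ C ∣ → ¬ ∣ C ∣ + s ≡ k
    refute-thin A C KA (A₂≢⊥ , A₂≢⊤) A₁⊆C A₁<C ∣C∣+s≡k =
      [ below , joined ]′ (closure-elim KA (G⇒K C GC))
      where
      GC : G s C
      GC = fat-in-closureIter ucF s C (size-nonempty C (≤-trans (s≤s z≤n) A₁<C))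
                                      (≤-reflexive (sym ∣C∣+s≡k))

      below : ¬ embed d C ⊆ A
      below C⊥⊆A = <⇒≱ A₁<C (p⊆q⇒∣p∣≤∣q∣ (subst (_⊆ low A) (low-embed C) (low-mono C⊥⊆A)))

      high∪ : high (A ∪ embed d C) ≡ high A
      high∪ = trans (part₂-∪ k A (embed d C))
                    (trans (cong (high A ∪_) (high-embed C)) (∪-identityʳ (high A)))

      low∪ : low (A ∪ embed d C) ≡ C
      low∪ = trans (part₁-∪ k A (embed d C))
                   (trans (cong (low A ∪_) (low-embed C)) (⊆⇒∪≡ A₁⊆C))

      joined : ¬ K s (A ∪ embed d C)
      joined K[A∪C] = mixed⇒fat (A ∪ embed d C) K[A∪C]
        ((λ e → A₂≢⊥ (trans (sym high∪) e)) , (λ e → A₂≢⊤ (trans (sym high∪) e)))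
        (subst (Thin s) (sym low∪) (≤-reflexive ∣C∣+s≡k))

    mixed⇒fat-suc : ∀ A → K (suc s) A → Mixed A → ¬ Thin (suc s) (low A)
    mixed⇒fat-suc A KA mixedA thin =
      let C , A₁⊆C , ∣C∣≡k∸s =
            superset-of-size (low A) (k ∸ s) (≤-trans (n≤1+n _) A₁<k∸s) (m∸n≤m k s)
      in refute-thin A C KA mixedA A₁⊆C (subst (∣ low A ∣ <_) (sym ∣C∣≡k∸s) A₁<k∸s)
           (trans (cong (_+ s) ∣C∣≡k∸s) (m∸n+n≡m s≤k))
      where
      s≤k : s ≤ k
      s≤k = ≤-trans (n≤1+n s) (m+n≤o⇒n≤o ∣ low A ∣ thin)

      A₁<k∸s : ∣ low A ∣ < k ∸ s
      A₁<k∸s = m+n≤o⇒m≤o∸n (suc ∣ low A ∣) (≤-trans (≤-reflexive (sym (+-suc ∣ low A ∣ s))) thin)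

    level-suc : Level (suc s)
    level-suc = record
      { G⇒K = G⇒K-suc ; K⇒G = K⇒G-suc ; mixed⇒fat = mixed⇒fat-suc ; fat⇒K = fat⇒K-suc }

  levels : ∀ s → Level s
  levels zero = level-zero
  levels (suc s) = Step.level-suc (levels s)

  open Level
  open Step using (criterion)

  in-if-embedded : ∀ t A → high A ≡ ⊥ → G t (low A) → K t A
  in-if-embedded t A A₂≡⊥ GA₁ = subst (K t) (embed-low A A₂≡⊥) (G⇒K (levels t) (low A) GA₁)

  out-if-embedded : ∀ t A → high A ≡ ⊥ → ¬ G t (low A) → ¬ K t A
  out-if-embedded t A A₂≡⊥ ¬GA₁ KA =
    ¬GA₁ (K⇒G (levels t) (low A) (subst (K t) (sym (embed-low A A₂≡⊥)) KA))

  -- Condition (iii), which in fact needs no assumption on A₂: A joins K (s + 1)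
  -- once it can be joined with every embedded member of K s not below it.
  in-if-joinable : ∀ s A → Nonempty A →
    (∀ E → G s E → ¬ embed d E ⊆ A → K s (embed d E ∪ A)) → K (suc s) A
  in-if-joinable s A A≠∅ joinable = criterion (levels s) A A≠∅ λ E KE E⊈A →
    subst (K s) (∪-comm (embed d E) A) (joinable E (K⇒G (levels s) E KE) E⊈A)

  out-if-unjoinable : ∀ s A E → G s E → ¬ embed d E ⊆ A → ¬ K s (embed d E ∪ A) → ¬ K (suc s) A
  out-if-unjoinable s A E GE E⊈A ¬K[E∪A] KA =
    [ E⊈A , (λ K[A∪E] → ¬K[E∪A] (subst (K s) (∪-comm A (embed d E)) K[A∪E])) ]′
      (closure-elim KA (G⇒K (levels s) E GE))

  -- Condition (v): ∣ A₁ ∣ ≥ k ∸ t + 1 means A₁ is not thin at level t.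
  in-if-large : ∀ t A → Nonempty A → suc (k ∸ t) ≤ ∣ low A ∣ → K t A
  in-if-large t A A≠∅ A₁-large =
    fat⇒K (levels t) A A≠∅ λ thin → <⇒≱ A₁-large (m+n≤o⇒m≤o∸n ∣ low A ∣ thin)

  -- Condition (vi): for t ≤ k, ∣ A₁ ∣ ≤ k ∸ t means A₁ is thin at level t.
  out-if-mixed-small : ∀ t A → t ≤ k → Mixed A → ∣ low A ∣ ≤ k ∸ t → ¬ K t A
  out-if-mixed-small t A t≤k mixedA A₁-small KA =
    mixed⇒fat (levels t) A KA mixedA (m≤o∸n⇒m+n≤o ∣ low A ∣ t≤k A₁-small)

theorem2 : (k d : ℕ) → 1 ≤ k → 2 ≤ d →
    (F : Family k) → UnionClosed k F → ¬ F ⊥ →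
    (A : Subset (k + d)) → Nonempty A →
    (t : ℕ) → 1 ≤ t → t ≤ k →
    (((part₂ k A ≡ ⊥ × closureIter k t F (part₁ k A))
      ⊎ (part₂ k A ≡ ⊤ ×
         ((E : Subset k) → closureIter k (t ∸ 1) F E → ¬ (embed d E ⊆ A) →
          closureIter (k + d) (t ∸ 1) (extend k d F) (embed d E ∪ A)))
      ⊎ suc (k ∸ t) ≤ ∣ part₁ k A ∣)
     → closureIter (k + d) t (extend k d F) A)
    ×
    (((part₂ k A ≡ ⊥ × ¬ closureIter k t F (part₁ k A))
      ⊎ (part₂ k A ≡ ⊤ ×
         Σ (Subset k) (λ E → closureIter k (t ∸ 1) F E × ¬ (embed d E ⊆ A) ×
          ¬ closureIter (k + d) (t ∸ 1) (extend k d F) (embed d E ∪ A)))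
      ⊎ (¬ part₂ k A ≡ ⊥ × ¬ part₂ k A ≡ ⊤ × ∣ part₁ k A ∣ ≤ k ∸ t))
     → ¬ closureIter (k + d) t (extend k d F) A)
theorem2 (suc k′) (suc (suc d′)) (s≤s z≤n) (s≤s (s≤s z≤n)) F ucF _ A A≠∅ (suc s) (s≤s z≤n) t≤k =
    [ uncurry (in-if-embedded (suc s) A)
    , [ (λ (_ , joinable) → in-if-joinable s A A≠∅ joinable)
      , in-if-large (suc s) A A≠∅ ]′ ]′
  , [ uncurry (out-if-embedded (suc s) A)
    , [ (λ (_ , E , GE , E⊈A , ¬K) → out-if-unjoinable s A E GE E⊈A ¬K)
      , (λ (A₂≢⊥ , A₂≢⊤ , A₁-small) → out-if-mixed-small (suc s) A t≤k (A₂≢⊥ , A₂≢⊤) A₁-small) ]′ ]′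
  where
  open Extension k′ (suc d′) F ucF
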